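{- Let $\Gamma$ be a finite graph without closed twins, let $G$ be a finite group, and let $n$ be a positive integer relatively prime to $|G|$. Then $\mathcal{P}_e(G\times\mathbb{Z}_n)$ is $\Gamma$-free if and only if $\mathcal{P}_e(G)$ is $\Gamma$-free.
   Context: For a finite group $G$, the enhanced power graph $\mathcal{P}_e(G)$ is the simple graph with vertex set $G$ in which two distinct vertices $x,y$ are adjacent if and only if $\langle x,y\rangle$ is cyclic. The closed neighborhood of a vertex $v$ is $\{v\}$ together with all vertices adjacent to $v$; a graph has no closed twins if no two distinct vertices have the same closed neighborhood. A graph is $\Gamma$-free if it has no induced subgraph isomorphic to $\Gamma$. $\mathbb{Z}_n$ is the cyclic group of order $n$. -}

module Defs where

open import Level using (Level; _⊔_; suc) renaming (zero to lzero)
open import Data.Nat using (ℕ) renaming (zero to nzero; suc to nsuc)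
open import Data.Integer using (ℤ; +_; -[1+_])
open import Data.Fin using (Fin)
open import Data.Product using (Σ; ∃; _×_; _,_)
open import Data.Sum using (_⊎_)
open import Relation.Nullary using (¬_; Dec)
open import Relation.Binary.PropositionalEquality using (_≡_)
open import Function.Bundles using (_⇔_)
open import Algebra.Bundles using (Group)

record FinGraph : Set₁ where
  field
    k      : ℕ
    Adj    : Fin k → Fin k → Set
    adj?   : ∀ i j → Dec (Adj i j)
    sym    : ∀ {i j} → Adj i j → Adj j i
    irrefl : ∀ {i} → ¬ Adj i i

ClosedNbhd : (Γ : FinGraph) → Fin (FinGraph.k Γ) → Fin (FinGraph.k Γ) → Set
ClosedNbhd Γ v w = (w ≡ v) ⊎ FinGraph.Adj Γ v w

NoClosedTwins : FinGraph → Set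
NoClosedTwins Γ = ∀ u v → (∀ w → ClosedNbhd Γ u w ⇔ ClosedNbhd Γ v w) → u ≡ v

module _ {c ℓ : Level} (G : Group c ℓ) where
  open Group G

  _^ℕ_ : Carrier → ℕ → Carrier
  x ^ℕ nzero  = ε
  x ^ℕ nsuc m = x ∙ (x ^ℕ m)

  _^ℤ_ : Carrier → ℤ → Carrier
  x ^ℤ (+ m)     = x ^ℕ m
  x ^ℤ -[1+ m ]  = (x ^ℕ nsuc m) ⁻¹

  InCyclic : Carrier → Carrier → Set ℓ
  InCyclic g x = ∃ λ (m : ℤ) → g ^ℤ m ≈ x

  data Word : Set where
    genL genR one : Word
    _·_           : Word → Word → Word
    inv           : Word → Word

  eval : Carrier → Carrier → Word → Carrier
  eval x y genL    = x
  eval x y genR    = y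
  eval x y one     = ε
  eval x y (u · v) = eval x y u ∙ eval x y v
  eval x y (inv u) = eval x y u ⁻¹

  InGen2 : Carrier → Carrier → Carrier → Set ℓ
  InGen2 x y g = ∃ λ (w : Word) → eval x y w ≈ g

  -- ⟨x , y⟩ is cyclic: it equals ⟨g⟩ for some g, i.e. g ∈ ⟨x,y⟩ and
  -- ⟨x,y⟩ ⊆ ⟨g⟩ (equivalently x, y ∈ ⟨g⟩)
  Gen2Cyclic : Carrier → Carrier → Set (c ⊔ ℓ)
  Gen2Cyclic x y = ∃ λ (g : Carrier) →
    InGen2 x y g × (∀ h → InGen2 x y h → InCyclic g h)

  EPAdj : Carrier → Carrier → Set (c ⊔ ℓ)
  EPAdj x y = (¬ (x ≈ y)) × Gen2Cyclic x y

  record IsFiniteGroup : Set (c ⊔ ℓ) where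
    field
      order   : ℕ
      enum    : Fin order → Carrier
      enum-inj : ∀ i j → enum i ≈ enum j → i ≡ j
      enum-surj : ∀ x → ∃ λ i → enum i ≈ x
      _≈?_    : ∀ x y → Dec (x ≈ y)

  -- H is a cyclic group of order n (i.e. H ≅ ℤ_n)
  record IsCyclicOfOrder (n : ℕ) : Set (c ⊔ ℓ) where
    field
      finite    : IsFiniteGroup
      order≡n   : IsFiniteGroup.order finite ≡ n
      generator : Carrier
      generates : ∀ x → InCyclic generator x

  InducedCopy : FinGraph → Set (c ⊔ ℓ)
  InducedCopy Γ = Σ (Fin (FinGraph.k Γ) → Carrier) λ f →
      (∀ i j → f i ≈ f j → i ≡ j)
    × (∀ i j → FinGraph.Adj Γ i j ⇔ EPAdj (f i) (f j))

  Free : FinGraph → Set (c ⊔ ℓ)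
  Free Γ = ¬ InducedCopy Γ

-- Whether ⟨(a , z) , (b , w)⟩ is cyclic in G × ℤₙ depends on a and b only. Projection preserves
-- cyclicity. Conversely, |G| annihilates G (Lagrange) and gcd (|G|, n) = 1, so there are exponents
-- K₁, K₂ acting on G × ℤₙ as (1 , 0) and (0 , 1); if g generates ⟨a , b⟩ and t generates ⟨z , w⟩
-- (ℤₙ is cyclic), then (g , t) lies in ⟨(a , z) , (b , w)⟩ and each of its elements (gⁱ , tʲ) equals
-- (g , t) ^ (i K₁ + j K₂). Hence x ↦ (x , 1) maps an induced copy of Γ in 𝒫ₑ(G) to one in
-- 𝒫ₑ(G × ℤₙ), and the first projection maps copies back: it is injective on a copy, since two
-- vertices with the same first coordinate would be closed twins.

module Submission where

open import Defs
open import Data.Nat using (ℕ; _>_)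
open import Data.Nat.Coprimality using (Coprime; coprime-Bézout)
import Data.Nat.Coprimality as Coprimality
open import Function.Bundles using (_⇔_; mk⇔; Equivalence)
open import Algebra.Bundles using (Group)
open import Algebra.Construct.DirectProduct using (group)

open import Level using (_⊔_)
import Data.Integer as ℤ
open import Data.Nat using (zero; suc; pred; _+_; _*_; _∸_; _≤_; _<_; s≤s; s≤s⁻¹; _≤?_)
open import Data.Nat.Divisibility using (_∣_; divides)
open import Data.Nat.GCD using (gcd; gcd-GCD; gcd[m,n]∣m; gcd[m,n]∣n; module Bézout)
open import Data.Nat.Tactic.RingSolver using (solve)
open import Data.Nat.DivMod using (_%_; _/_; m%n<n; m≡m%n+[m/n]*n)
open import Relation.Binary.Definitions using (tri<; tri≈; tri>)
open import Data.Nat.Properties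
open import Data.Fin using (Fin; toℕ; fromℕ<) renaming (zero to fzero; suc to fsuc)
import Data.Fin.Properties as Fin
open import Data.Fin.Permutation using (Permutation′; permutation; _⟨$⟩ʳ_)
open import Data.List using (allFin; []; _∷_)
open import Data.List.Membership.Propositional.Properties using (∈-allFin)
import Data.List.Relation.Unary.All as All
open import Data.List.Extrema ≤-totalOrder using (argmin; f[argmin]≤f[xs])
open import Data.Product using (∃; ∃₂; ∃!; _×_; _,_; proj₁; proj₂)
open import Data.Sum using (inj₁; inj₂)
open import Function using (_∘_)
open import Relation.Nullary using (¬_; Dec; yes; no; contradiction)
open import Relation.Unary using (Pred; Decidable)
open import Relation.Binary.PropositionalEquality as ≡ using (_≡_)
open import Algebra.Morphism.Structures using (module GroupMorphisms)
open import Algebra.Morphism.Construct.DirectProduct using () renaming (module Monoid to MonoidHomomorphisms)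
open import Algebra.Properties.CommutativeMonoid.Sum +-0-commutativeMonoid using (sum; sum-permute; ∑-comm; sum-cong-≗)

least : ∀ {p} {P : Pred ℕ p} → Decidable P → ∃ P → ∃ λ m → P m × (∀ {k} → k < m → ¬ P k)
least P? (zero , p) = 0 , p , λ ()
least P? (suc n , p) with P? 0 | least (P? ∘ suc) (n , p)
... | yes p₀ | _ = 0 , p₀ , λ ()
... | no ¬p₀ | m , pm , below = suc m , pm , λ { {zero} _ → ¬p₀ ; {suc k} (s≤s k<m) → below k<m }

minimiser : ∀ {n} (f : Fin (suc n) → ℕ) → ∃ λ i → ∀ j → f i ≤ f j
minimiser f = argmin f fzero (allFin _) , λ j → All.lookup (f[argmin]≤f[xs] {f = f} fzero (allFin _)) (∈-allFin j)

indicator : ∀ {p} {A : Set p} → Dec A → ℕ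
indicator (yes _) = 1
indicator (no _)  = 0

count : ∀ {n p} {P : Pred (Fin n) p} → Decidable P → ℕ
count P? = sum (λ i → indicator (P? i))

count-none : ∀ {n p} {P : Pred (Fin n) p} (P? : Decidable P) → (∀ i → ¬ P i) → count P? ≡ 0
count-none {zero} P? ¬P = ≡.refl
count-none {suc n} {P = P} P? ¬P with P? fzero
... | yes p = contradiction p (¬P fzero)
... | no _ = count-none {P = P ∘ fsuc} (P? ∘ fsuc) (¬P ∘ fsuc)

count-unique : ∀ {n p} {P : Pred (Fin n) p} (P? : Decidable P) → ∃! _≡_ P → count P? ≡ 1
count-unique {P = P} P? (fzero , p , unique) with P? fzero
... | no ¬p = contradiction p ¬p
... | yes _ = ≡.cong suc (count-none {P = P ∘ fsuc} (P? ∘ fsuc) (λ i → Fin.0≢1+n ∘ unique))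
count-unique {P = P} P? (fsuc i , p , unique) with P? fzero
... | yes p₀ = contradiction (≡.sym (unique p₀)) Fin.0≢1+n
... | no _ = count-unique {P = P ∘ fsuc} (P? ∘ fsuc) (i , p , Fin.suc-injective ∘ unique)

sum-const : ∀ n k → sum {n} (λ _ → k) ≡ n * k
sum-const zero k = ≡.refl
sum-const (suc n) k = ≡.cong (k +_) (sum-const n k)

-- Every orbit {σ i y | i} has suc d elements and exactly one element of least index.
module FreeOrbits {d N : ℕ} (σ : Fin (suc d) → Permutation′ N)
  (closed : ∀ y i j → ∃ λ k → σ j ⟨$⟩ʳ (σ i ⟨$⟩ʳ y) ≡ σ k ⟨$⟩ʳ y)
  (transitive : ∀ y i k → ∃ λ j → σ j ⟨$⟩ʳ (σ i ⟨$⟩ʳ y) ≡ σ k ⟨$⟩ʳ y)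
  (free : ∀ y {i j} → σ i ⟨$⟩ʳ y ≡ σ j ⟨$⟩ʳ y → i ≡ j) where

  LeastInOrbit : Pred (Fin N) _
  LeastInOrbit y = ∀ j → toℕ y ≤ toℕ (σ j ⟨$⟩ʳ y)

  leastInOrbit? : Decidable LeastInOrbit
  leastInOrbit? y = Fin.all? λ j → toℕ y ≤? toℕ (σ j ⟨$⟩ʳ y)

  unique-leastInOrbit : ∀ y → ∃! _≡_ (λ i → LeastInOrbit (σ i ⟨$⟩ʳ y))
  unique-leastInOrbit y = i₀ , i₀-least , λ {i} i-least →
    free y (Fin.toℕ-injective (≤-antisym (min i) (i≤i₀ i i-least)))
    where
    v : Fin (suc d) → ℕ
    v i = toℕ (σ i ⟨$⟩ʳ y)
    i₀ = proj₁ (minimiser v)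
    min = proj₂ (minimiser v)
    i₀-least : LeastInOrbit (σ i₀ ⟨$⟩ʳ y)
    i₀-least j with k , eq ← closed y i₀ j = ≡.subst (v i₀ ≤_) (≡.cong toℕ (≡.sym eq)) (min k)
    i≤i₀ : ∀ i → LeastInOrbit (σ i ⟨$⟩ʳ y) → v i ≤ v i₀
    i≤i₀ i i-least with j , eq ← transitive y i i₀ = ≡.subst (v i ≤_) (≡.cong toℕ eq) (i-least j)

  orbit-counting : N ≡ suc d * count leastInOrbit?
  orbit-counting = begin
    N                                              ≡⟨ *-identityʳ N ⟨
    N * 1                                          ≡⟨ sum-const N 1 ⟨
    sum (λ (y : Fin N) → 1)                        ≡⟨ sum-cong-≗ orbit-count ⟨
    sum (λ y → sum λ i → [ σ i ⟨$⟩ʳ y ])             ≡⟨ ∑-comm (λ y i → [ σ i ⟨$⟩ʳ y ]) ⟩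
    sum (λ i → sum λ y → [ σ i ⟨$⟩ʳ y ])             ≡⟨ sum-cong-≗ (λ i → sum-permute [_] (σ i)) ⟨
    sum (λ (i : Fin (suc d)) → count leastInOrbit?) ≡⟨ sum-const (suc d) _ ⟩
    suc d * count leastInOrbit?                    ∎
    where
    open ≡.≡-Reasoning
    [_] : Fin N → ℕ
    [ y ] = indicator (leastInOrbit? y)
    orbit-count : ∀ y → sum (λ i → [ σ i ⟨$⟩ʳ y ]) ≡ 1
    orbit-count y = count-unique (λ i → leastInOrbit? (σ i ⟨$⟩ʳ y)) (unique-leastInOrbit y)

module Powers {c ℓ} (G : Group c ℓ) where
  open Group G
  open import Algebra.Properties.Monoid.Mult monoid using (×-congʳ; ×-homo-+; ×-assocˡ) renaming (_×_ to _·ℕ_)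
  open import Algebra.Properties.Group G using (∙-cancelʳ)
  open import Relation.Binary.Reasoning.Setoid setoid

  infixr 8 _^_
  _^_ : Carrier → ℕ → Carrier
  _^_ = _^ℕ_ G

  ^≡× : ∀ x m → x ^ m ≡ m ·ℕ x
  ^≡× x zero = ≡.refl
  ^≡× x (suc m) = ≡.cong (x ∙_) (^≡× x m)

  ^-congˡ : ∀ {x y} m → x ≈ y → x ^ m ≈ y ^ m
  ^-congˡ {x} {y} m x≈y rewrite ^≡× x m | ^≡× y m = ×-congʳ m x≈y

  ^-homo-+ : ∀ x m n → x ^ (m + n) ≈ x ^ m ∙ x ^ n
  ^-homo-+ x m n rewrite ^≡× x (m + n) | ^≡× x m | ^≡× x n = ×-homo-+ x m n

  ^-assoc : ∀ x m n → (x ^ n) ^ m ≈ x ^ (m * n)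
  ^-assoc x m n rewrite ^≡× (x ^ n) m | ^≡× x n | ^≡× x (m * n) = ×-assocˡ x m n

  ε^ : ∀ m → ε ^ m ≈ ε
  ε^ zero = refl
  ε^ (suc m) = trans (identityˡ _) (ε^ m)

  ^-cancel : ∀ x i k → x ^ (k + i) ≈ x ^ i → x ^ k ≈ ε
  ^-cancel x i k eq = ∙-cancelʳ (x ^ i) _ _ (begin
    x ^ k ∙ x ^ i  ≈⟨ ^-homo-+ x k i ⟨
    x ^ (k + i)    ≈⟨ eq ⟩
    x ^ i          ≈⟨ identityˡ _ ⟨
    ε ∙ x ^ i      ∎)

  ^-*-annihilated : ∀ {x n} q → x ^ n ≈ ε → x ^ (q * n) ≈ ε
  ^-*-annihilated {x} {n} q xⁿ≈ε = begin
    x ^ (q * n)   ≈⟨ ^-assoc x q n ⟨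
    (x ^ n) ^ q   ≈⟨ ^-congˡ q xⁿ≈ε ⟩
    ε ^ q         ≈⟨ ε^ q ⟩
    ε             ∎

  ^-suc-*-annihilated : ∀ {x n} q → x ^ n ≈ ε → x ^ suc (q * n) ≈ x
  ^-suc-*-annihilated q xⁿ≈ε = trans (∙-congˡ (^-*-annihilated q xⁿ≈ε)) (identityʳ _)

  ^-*-fixed : ∀ {x K} i → x ^ K ≈ x → x ^ (i * K) ≈ x ^ i
  ^-*-fixed {x} {K} i xᴷ≈x = trans (sym (^-assoc x i K)) (^-congˡ i xᴷ≈x)

  ^-+-fixed-annihilated : ∀ {x K L} i j → x ^ K ≈ x → x ^ L ≈ ε → x ^ (i * K + j * L) ≈ x ^ i
  ^-+-fixed-annihilated {x} {K} {L} i j xᴷ≈x xᴸ≈ε = begin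
    x ^ (i * K + j * L)      ≈⟨ ^-homo-+ x (i * K) (j * L) ⟩
    x ^ (i * K) ∙ x ^ (j * L) ≈⟨ ∙-cong (^-*-fixed i xᴷ≈x) (^-*-annihilated j xᴸ≈ε) ⟩
    x ^ i ∙ ε                ≈⟨ identityʳ _ ⟩
    x ^ i                    ∎

  Annihilates : ℕ → Set (c ⊔ ℓ)
  Annihilates e = ∀ x → x ^ e ≈ ε

  InCyclicℕ : Carrier → Carrier → Set ℓ
  InCyclicℕ g h = ∃ λ k → g ^ k ≈ h

  InCyclicℕ-∣ : ∀ {d n} x → d ∣ n → InCyclicℕ (x ^ d) (x ^ n)
  InCyclicℕ-∣ {d} x (divides q n≡q*d) = q , trans (^-assoc x q d) (reflexive (≡.cong (x ^_) (≡.sym n≡q*d)))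

-- Lagrange's theorem for cyclic subgroups

m<n⇒∃[o]suc[o+m]≡n : ∀ {i j} → i < j → ∃ λ k → suc k + i ≡ j
m<n⇒∃[o]suc[o+m]≡n {i} {j} i<j = j ∸ suc i , ≡.trans (≡.sym (+-suc (j ∸ suc i) i)) (m∸n+n≡m i<j)

module FiniteGroup {c ℓ} (G : Group c ℓ) (finite : IsFiniteGroup G) where
  open Group G
  open IsFiniteGroup finite
  open Powers G
  open import Algebra.Properties.Group G using (∙-cancelʳ)
  open import Relation.Binary.Reasoning.Setoid setoid

  index : Carrier → Fin order
  index x = proj₁ (enum-surj x)

  enum-index : ∀ x → enum (index x) ≈ x
  enum-index x = proj₂ (enum-surj x)

  translate : Carrier → Fin order → Fin order
  translate g y = index (g ∙ enum y)

  translate-∙ : ∀ g h y → translate g (translate h y) ≡ translate (g ∙ h) y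
  translate-∙ g h y = enum-inj _ _ (begin
    enum (translate g (translate h y)) ≈⟨ enum-index _ ⟩
    g ∙ enum (translate h y)           ≈⟨ ∙-congˡ (enum-index _) ⟩
    g ∙ (h ∙ enum y)                   ≈⟨ assoc g h _ ⟨
    (g ∙ h) ∙ enum y                   ≈⟨ enum-index _ ⟨
    enum (translate (g ∙ h) y)         ∎)

  translate-cong : ∀ {g h} y → g ≈ h → translate g y ≡ translate h y
  translate-cong y g≈h = enum-inj _ _ (trans (enum-index _) (trans (∙-congʳ g≈h) (sym (enum-index _))))

  translate-cancel : ∀ {g h} y → translate g y ≡ translate h y → g ≈ h
  translate-cancel {g} {h} y eq = ∙-cancelʳ (enum y) g h
    (trans (sym (enum-index _)) (trans (reflexive (≡.cong enum eq)) (enum-index _)))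

  translate-inverse : ∀ {g h} y → g ∙ h ≈ ε → translate g (translate h y) ≡ y
  translate-inverse {g} {h} y g∙h≈ε = ≡.trans (translate-∙ g h y) (enum-inj _ _ (begin
    enum (translate (g ∙ h) y) ≈⟨ enum-index _ ⟩
    (g ∙ h) ∙ enum y           ≈⟨ ∙-congʳ g∙h≈ε ⟩
    ε ∙ enum y                 ≈⟨ identityˡ _ ⟩
    enum y                     ∎))

  translation : Carrier → Permutation′ order
  translation g = permutation (translate g) (translate (g ⁻¹))
    (λ y → translate-inverse y (inverseʳ g)) (λ y → translate-inverse y (inverseˡ g))

  module Period (a : Carrier) where
    repeat⇒period : ∀ {i j} → i < j → a ^ i ≈ a ^ j → ∃ λ k → k < j × a ^ suc k ≈ ε
    repeat⇒period {i} {j} i<j aⁱ≈aʲ with k , k+i≡j ← m<n⇒∃[o]suc[o+m]≡n i<j =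
      k , ≤-trans (m≤m+n (suc k) i) (≤-reflexive k+i≡j) ,
      ^-cancel a i (suc k) (trans (reflexive (≡.cong (a ^_) k+i≡j)) (sym aⁱ≈aʲ))

    opaque
      eventually-ε : ∃ λ k → a ^ suc k ≈ ε
      eventually-ε with i , j , i<j , eq ← Fin.pigeonhole (n<1+n order) (λ i → index (a ^ toℕ i)) =
        let k , _ , aᵏ≈ε = repeat⇒period i<j (begin
              a ^ toℕ i                 ≈⟨ enum-index _ ⟨
              enum (index (a ^ toℕ i))  ≡⟨ ≡.cong enum eq ⟩
              enum (index (a ^ toℕ j))  ≈⟨ enum-index _ ⟩
              a ^ toℕ j                 ∎)
        in k , aᵏ≈ε

      least-period : ∃ λ d → a ^ suc d ≈ ε × (∀ {k} → k < d → ¬ a ^ suc k ≈ ε)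
      least-period = least (λ k → (a ^ suc k) ≈? ε) eventually-ε

    period : ℕ
    period = suc (proj₁ least-period)

    ^-period : a ^ period ≈ ε
    ^-period = proj₁ (proj₂ least-period)

    ^-injective : ∀ {i j} → i < period → j < period → a ^ i ≈ a ^ j → i ≡ j
    ^-injective {i} {j} i<p j<p aⁱ≈aʲ with <-cmp i j
    ... | tri≈ _ i≡j _ = i≡j
    ... | tri< i<j _ _ = let k , k<j , aᵏ≈ε = repeat⇒period i<j aⁱ≈aʲ in
      contradiction aᵏ≈ε (proj₂ (proj₂ least-period) (≤-trans k<j (s≤s⁻¹ j<p)))
    ... | tri> _ _ j<i = let k , k<i , aᵏ≈ε = repeat⇒period j<i (sym aⁱ≈aʲ) in
      contradiction aᵏ≈ε (proj₂ (proj₂ least-period) (≤-trans k<i (s≤s⁻¹ i<p)))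

    ^-reduce : ∀ m → ∃ λ (k : Fin period) → a ^ m ≈ a ^ toℕ k
    ^-reduce m = fromℕ< (m%n<n m period) , (begin
      a ^ m                                ≡⟨ ≡.cong (a ^_) (m≡m%n+[m/n]*n m period) ⟩
      a ^ (m % period + m / period * period) ≈⟨ ^-homo-+ a (m % period) (m / period * period) ⟩
      a ^ (m % period) ∙ a ^ (m / period * period) ≈⟨ ∙-congˡ (^-*-annihilated (m / period) ^-period) ⟩
      a ^ (m % period) ∙ ε                 ≈⟨ identityʳ _ ⟩
      a ^ (m % period)                     ≡⟨ ≡.cong (a ^_) (Fin.toℕ-fromℕ< (m%n<n m period)) ⟨
      a ^ toℕ (fromℕ< (m%n<n m period))    ∎)

    private
      ^-complement : ∀ m {i} → i ≤ period → a ^ (m + (period ∸ i)) ∙ a ^ i ≈ a ^ m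
      ^-complement m {i} i≤p = begin
        a ^ (m + (period ∸ i)) ∙ a ^ i ≈⟨ ^-homo-+ a (m + (period ∸ i)) i ⟨
        a ^ (m + (period ∸ i) + i)     ≡⟨ ≡.cong (a ^_) (+-assoc m (period ∸ i) i) ⟩
        a ^ (m + (period ∸ i + i))     ≡⟨ ≡.cong (λ e → a ^ (m + e)) (m∸n+n≡m i≤p) ⟩
        a ^ (m + period)               ≈⟨ ^-homo-+ a m period ⟩
        a ^ m ∙ a ^ period             ≈⟨ ∙-congˡ ^-period ⟩
        a ^ m ∙ ε                      ≈⟨ identityʳ _ ⟩
        a ^ m                          ∎

      σ : Fin period → Permutation′ order
      σ i = translation (a ^ toℕ i)

      translate-powers : ∀ i j k y → a ^ j ∙ a ^ i ≈ a ^ k →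
        translate (a ^ j) (translate (a ^ i) y) ≡ translate (a ^ k) y
      translate-powers i j k y eq = ≡.trans (translate-∙ (a ^ j) (a ^ i) y) (translate-cong y eq)

      closed : ∀ y i j → ∃ λ k → σ j ⟨$⟩ʳ (σ i ⟨$⟩ʳ y) ≡ σ k ⟨$⟩ʳ y
      closed y i j with k , eq ← ^-reduce (toℕ j + toℕ i) =
        k , translate-powers (toℕ i) (toℕ j) (toℕ k) y (trans (sym (^-homo-+ a (toℕ j) (toℕ i))) eq)

      transitive : ∀ y i k → ∃ λ j → σ j ⟨$⟩ʳ (σ i ⟨$⟩ʳ y) ≡ σ k ⟨$⟩ʳ y
      transitive y i k with j , eq ← ^-reduce (toℕ k + (period ∸ toℕ i)) =
        j , translate-powers (toℕ i) (toℕ j) (toℕ k) y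
              (trans (∙-congʳ (sym eq)) (^-complement (toℕ k) (<⇒≤ (Fin.toℕ<n i))))

      free : ∀ y {i j} → σ i ⟨$⟩ʳ y ≡ σ j ⟨$⟩ʳ y → i ≡ j
      free y {i} {j} eq = Fin.toℕ-injective
        (^-injective (Fin.toℕ<n i) (Fin.toℕ<n j) (translate-cancel y eq))

    period∣order : period ∣ order
    period∣order = divides (count leastInOrbit?) (≡.trans orbit-counting (*-comm period _))
      where open FreeOrbits σ closed transitive free

  ^-order : ∀ a → a ^ order ≈ ε
  ^-order a = trans (reflexive (≡.cong (a ^_) (_∣_.equality period∣order)))
    (^-*-annihilated (_∣_.quotient period∣order) ^-period)
    where open Period a

  suc-pred-order : suc (pred order) ≡ order
  suc-pred-order = suc-pred order {{Fin.nonZeroIndex (index ε)}}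

  annihilated : Annihilates (suc (pred order))
  annihilated = ≡.subst Annihilates (≡.sym suc-pred-order) ^-order

module Words {c ℓ} (G : Group c ℓ) where
  open Group G
  open Powers G
  open import Algebra.Properties.Group G using (x≈z//y)
  open import Relation.Binary.Reasoning.Setoid setoid

  infixr 8 _^ʷ_
  _^ʷ_ : Word G → ℕ → Word G
  w ^ʷ zero  = one
  w ^ʷ suc k = w · (w ^ʷ k)

  eval-^ʷ : ∀ x y w k → eval G x y (w ^ʷ k) ≈ eval G x y w ^ k
  eval-^ʷ x y w zero    = refl
  eval-^ʷ x y w (suc k) = ∙-congˡ (eval-^ʷ x y w k)

  eval-cong : ∀ {x x′ y y′} w → x ≈ x′ → y ≈ y′ → eval G x y w ≈ eval G x′ y′ w
  eval-cong genL    x≈x′ y≈y′ = x≈x′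
  eval-cong genR    x≈x′ y≈y′ = y≈y′
  eval-cong one     x≈x′ y≈y′ = refl
  eval-cong (u · v) x≈x′ y≈y′ = ∙-cong (eval-cong u x≈x′ y≈y′) (eval-cong v x≈x′ y≈y′)
  eval-cong (inv u) x≈x′ y≈y′ = ⁻¹-cong (eval-cong u x≈x′ y≈y′)

  Gen2Cyclic-respˡ : ∀ {x x′ y} → x ≈ x′ → Gen2Cyclic G x y → Gen2Cyclic G x′ y
  Gen2Cyclic-respˡ x≈x′ (g , (w , w≈g) , cyclic) =
    g , (w , trans (eval-cong w (sym x≈x′) refl) w≈g) ,
    λ h (v , v≈h) → cyclic h (v , trans (eval-cong v x≈x′ refl) v≈h)

  module _ (t : Carrier) (α β : ℕ) where
    private
      evalᵗ : Word G → Carrier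
      evalᵗ = eval G (t ^ α) (t ^ β)

      genL-^ʷ : ∀ k → evalᵗ (genL ^ʷ k) ≈ t ^ (k * α)
      genL-^ʷ k = trans (eval-^ʷ _ _ genL k) (^-assoc t k α)

      genR-^ʷ : ∀ k → evalᵗ (genR ^ʷ k) ≈ t ^ (k * β)
      genR-^ʷ k = trans (eval-^ʷ _ _ genR k) (^-assoc t k β)

      shift : ∀ d m n u v → evalᵗ u ≈ t ^ m → evalᵗ v ≈ t ^ n → d + m ≡ n →
        t ^ d ≈ evalᵗ v ∙ evalᵗ u ⁻¹
      shift d m n u v u≈tᵐ v≈tⁿ d+m≡n = x≈z//y _ _ _ (begin
        t ^ d ∙ evalᵗ u  ≈⟨ ∙-congˡ u≈tᵐ ⟩
        t ^ d ∙ t ^ m    ≈⟨ ^-homo-+ t d m ⟨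
        t ^ (d + m)      ≡⟨ ≡.cong (t ^_) d+m≡n ⟩
        t ^ n            ≈⟨ v≈tⁿ ⟨
        evalᵗ v          ∎)

    gcd-InGen2 : InGen2 G (t ^ α) (t ^ β) (t ^ gcd α β)
    gcd-InGen2 with Bézout.identity (gcd-GCD α β)
    ... | Bézout.+- x y eq = (genL ^ʷ x) · inv (genR ^ʷ y) ,
      sym (shift (gcd α β) (y * β) (x * α) (genR ^ʷ y) (genL ^ʷ x) (genR-^ʷ y) (genL-^ʷ x) eq)
    ... | Bézout.-+ x y eq = (genR ^ʷ y) · inv (genL ^ʷ x) ,
      sym (shift (gcd α β) (x * α) (y * β) (genL ^ʷ x) (genR ^ʷ y) (genL-^ʷ x) (genR-^ʷ y) eq)

module Annihilated {c ℓ} (G : Group c ℓ) (e : ℕ) (annihilates : Powers.Annihilates G (suc e)) where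
  open Group G
  open Powers G
  open Words G
  open import Algebra.Properties.Group G using (inverseˡ-unique)
  open import Relation.Binary.Reasoning.Setoid setoid

  ^-⁻¹ : ∀ x k → (x ^ k) ⁻¹ ≈ x ^ (k * e)
  ^-⁻¹ x k = sym (inverseˡ-unique _ _ (begin
    x ^ (k * e) ∙ x ^ k ≈⟨ ^-homo-+ x (k * e) k ⟨
    x ^ (k * e + k)     ≡⟨ ≡.cong (x ^_) (≡.trans (+-comm (k * e) k) (≡.sym (*-suc k e))) ⟩
    x ^ (k * suc e)     ≈⟨ ^-*-annihilated k (annihilates x) ⟩
    ε                   ∎))

  InCyclic⇒InCyclicℕ : ∀ {g h} → InCyclic G g h → InCyclicℕ g h
  InCyclic⇒InCyclicℕ (ℤ.+ k , gᵏ≈h) = k , gᵏ≈h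
  InCyclic⇒InCyclicℕ {g} (ℤ.-[1+ k ] , g⁻ᵏ≈h) = suc k * e , trans (sym (^-⁻¹ g (suc k))) g⁻ᵏ≈h

  eval-InCyclicℕ : ∀ {g x y} → InCyclicℕ g x → InCyclicℕ g y → ∀ w → InCyclicℕ g (eval G x y w)
  eval-InCyclicℕ x∈ y∈ genL = x∈
  eval-InCyclicℕ x∈ y∈ genR = y∈
  eval-InCyclicℕ x∈ y∈ one  = 0 , refl
  eval-InCyclicℕ {g} x∈ y∈ (u · v)
    with k , gᵏ≈u ← eval-InCyclicℕ x∈ y∈ u | l , gˡ≈v ← eval-InCyclicℕ x∈ y∈ v =
    k + l , trans (^-homo-+ g k l) (∙-cong gᵏ≈u gˡ≈v)
  eval-InCyclicℕ {g} x∈ y∈ (inv u) with k , gᵏ≈u ← eval-InCyclicℕ x∈ y∈ u =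
    k * e , trans (sym (^-⁻¹ g k)) (⁻¹-cong gᵏ≈u)

  Gen2Cyclic-of-powers : ∀ {g x y} → InGen2 G x y g → InCyclicℕ g x → InCyclicℕ g y → Gen2Cyclic G x y
  Gen2Cyclic-of-powers {g} g∈ x∈ y∈ = g , g∈ , λ h (w , w≈h) →
    let k , gᵏ≈w = eval-InCyclicℕ x∈ y∈ w in ℤ.+ k , trans gᵏ≈w w≈h

  Gen2Cyclic-reflexive : ∀ {x y} → x ≈ y → Gen2Cyclic G x y
  Gen2Cyclic-reflexive {x} {y} x≈y =
    Gen2Cyclic-of-powers (genR , refl) (1 , trans (identityʳ y) (sym x≈y)) (1 , identityʳ y)

  cyclic⇒Gen2Cyclic : ∀ {t} → (∀ x → InCyclic G t x) → ∀ z w → Gen2Cyclic G z w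
  cyclic⇒Gen2Cyclic {t} generates z w
    with α , tᵅ≈z ← InCyclic⇒InCyclicℕ (generates z) | β , tᵝ≈w ← InCyclic⇒InCyclicℕ (generates w) =
    Gen2Cyclic-of-powers (u , trans (eval-cong u (sym tᵅ≈z) (sym tᵝ≈w)) u≈tᵈ)
      (resp tᵅ≈z (InCyclicℕ-∣ t (gcd[m,n]∣m α β))) (resp tᵝ≈w (InCyclicℕ-∣ t (gcd[m,n]∣n α β)))
    where
    u = proj₁ (gcd-InGen2 t α β)
    u≈tᵈ = proj₂ (gcd-InGen2 t α β)
    resp : ∀ {g h h′} → h ≈ h′ → InCyclicℕ g h → InCyclicℕ g h′
    resp h≈h′ (k , gᵏ≈h) = k , trans gᵏ≈h h≈h′

coprime⇒suc[q*m]≡r*n : ∀ m′ n′ → Coprime (suc m′) (suc n′) →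
  ∃₂ λ q r → suc (q * suc m′) ≡ r * suc n′
coprime⇒suc[q*m]≡r*n m′ n′ coprime with coprime-Bézout coprime
... | Bézout.-+ x y eq = x , y , eq
... | Bézout.+- x y eq = x * m′ + n′ , y * m′ + suc m′ , (begin
  suc ((x * m′ + n′) * suc m′)          ≡⟨ solve (x ∷ m′ ∷ n′ ∷ []) ⟩
  m′ * (x * suc m′) + suc (n′ * suc m′) ≡⟨ ≡.cong (λ t → m′ * t + suc (n′ * suc m′)) eq ⟨
  m′ * suc (y * suc n′) + suc (n′ * suc m′) ≡⟨ solve (y ∷ m′ ∷ n′ ∷ []) ⟩
  (y * m′ + suc m′) * suc n′            ∎)
  where open ≡.≡-Reasoning

module _ {c ℓ c′ ℓ′} {G : Group c ℓ} {H : Group c′ ℓ′} where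
  private
    module G = Group G
    module H = Group H
  open GroupMorphisms G.rawGroup H.rawGroup using (IsGroupHomomorphism)

  transport : Word G → Word H
  transport genL    = genL
  transport genR    = genR
  transport one     = one
  transport (u · v) = transport u · transport v
  transport (inv u) = inv (transport u)

  eval-homo : ∀ {φ} → IsGroupHomomorphism φ →
    ∀ x y w → φ (eval G x y w) H.≈ eval H (φ x) (φ y) (transport w)
  eval-homo φ-homo x y genL    = H.refl
  eval-homo φ-homo x y genR    = H.refl
  eval-homo φ-homo x y one     = IsGroupHomomorphism.ε-homo φ-homo
  eval-homo φ-homo x y (u · v) = H.trans (IsGroupHomomorphism.homo φ-homo _ _)
    (H.∙-cong (eval-homo φ-homo x y u) (eval-homo φ-homo x y v))
  eval-homo φ-homo x y (inv u) = H.trans (IsGroupHomomorphism.⁻¹-homo φ-homo _)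
    (H.⁻¹-cong (eval-homo φ-homo x y u))

transport-involutive : ∀ {c ℓ c′ ℓ′} {G : Group c ℓ} {H : Group c′ ℓ′} (w : Word G) →
  transport {H = G} (transport {H = H} w) ≡ w
transport-involutive genL    = ≡.refl
transport-involutive genR    = ≡.refl
transport-involutive one     = ≡.refl
transport-involutive (u · v) = ≡.cong₂ _·_ (transport-involutive u) (transport-involutive v)
transport-involutive (inv u) = ≡.cong inv (transport-involutive u)

module _ {c ℓ c′ ℓ′} (G : Group c ℓ) (H : Group c′ ℓ′) where
  private
    module G = Group G
    module H = Group H
    module PG = Powers G
    module PH = Powers H

  coprime⇒separating-exponent : ∀ m′ n′ → PG.Annihilates (suc m′) → PH.Annihilates (suc n′) →
    Coprime (suc m′) (suc n′) → ∃ λ K → (∀ x → x PG.^ K G.≈ x) × (∀ y → y PH.^ K H.≈ H.ε)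
  coprime⇒separating-exponent m′ n′ annG annH coprime with q , r , eq ← coprime⇒suc[q*m]≡r*n m′ n′ coprime =
    r * suc n′ ,
    (λ x → G.trans (G.reflexive (≡.cong (x PG.^_) (≡.sym eq))) (PG.^-suc-*-annihilated q (annG x))) ,
    (λ y → PH.^-*-annihilated r (annH y))

module DirectProduct {c ℓ c′ ℓ′} (G : Group c ℓ) (H : Group c′ ℓ′) where
  private
    P = group G H
    module G = Group G
    module H = Group H
    module P = Group P
    module PG = Powers G
    module PH = Powers H
    module PP = Powers P
    module WP = Words P
  open GroupMorphisms using (IsGroupHomomorphism)
  open MonoidHomomorphisms using (module Proj₁; module Proj₂)

  proj₁-homo : IsGroupHomomorphism P.rawGroup G.rawGroup proj₁
  proj₁-homo = record
    { isMonoidHomomorphism = Proj₁.isMonoidHomomorphism G.rawMonoid H.rawMonoid G.refl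
    ; ⁻¹-homo = λ _ → G.refl
    }

  proj₂-homo : IsGroupHomomorphism P.rawGroup H.rawGroup proj₂
  proj₂-homo = record
    { isMonoidHomomorphism = Proj₂.isMonoidHomomorphism G.rawMonoid H.rawMonoid H.refl
    ; ⁻¹-homo = λ _ → H.refl
    }

  ^-× : ∀ X k → X PP.^ k P.≈ (proj₁ X PG.^ k , proj₂ X PH.^ k)
  ^-× X zero    = P.refl
  ^-× X (suc k) = P.∙-congˡ (^-× X k)

  ^ℤ-proj₁ : ∀ X k → proj₁ (_^ℤ_ P X k) G.≈ _^ℤ_ G (proj₁ X) k
  ^ℤ-proj₁ X (ℤ.+ k)     = proj₁ (^-× X k)
  ^ℤ-proj₁ X ℤ.-[1+ k ] = G.⁻¹-cong (proj₁ (^-× X (suc k)))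

  proj₁-InGen2 : ∀ {X Y h} → InGen2 P X Y h → InGen2 G (proj₁ X) (proj₁ Y) (proj₁ h)
  proj₁-InGen2 {X} {Y} (w , w≈h) = transport w , G.trans (G.sym (eval-homo proj₁-homo X Y w)) (proj₁ w≈h)

  proj₂-InGen2 : ∀ {X Y h} → InGen2 P X Y h → InGen2 H (proj₂ X) (proj₂ Y) (proj₂ h)
  proj₂-InGen2 {X} {Y} (w , w≈h) = transport w , H.trans (H.sym (eval-homo proj₂-homo X Y w)) (proj₂ w≈h)

  eval-transport₁ : ∀ X Y w → proj₁ (eval P X Y (transport w)) G.≈ eval G (proj₁ X) (proj₁ Y) w
  eval-transport₁ X Y w = G.trans (eval-homo proj₁-homo X Y (transport w))
    (G.reflexive (≡.cong (eval G (proj₁ X) (proj₁ Y)) (transport-involutive w)))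

  eval-transport₂ : ∀ X Y w → proj₂ (eval P X Y (transport w)) H.≈ eval H (proj₂ X) (proj₂ Y) w
  eval-transport₂ X Y w = H.trans (eval-homo proj₂-homo X Y (transport w))
    (H.reflexive (≡.cong (eval H (proj₂ X) (proj₂ Y)) (transport-involutive w)))

  Gen2Cyclic-proj₁ : ∀ {X Y} → Gen2Cyclic P X Y → Gen2Cyclic G (proj₁ X) (proj₁ Y)
  Gen2Cyclic-proj₁ {X} {Y} (Q , Q∈ , cyclic) = proj₁ Q , proj₁-InGen2 Q∈ , λ h (w , w≈h) →
    let k , Qᵏ≈ = cyclic (eval P X Y (transport w)) (transport w , P.refl)
    in k , G.trans (G.sym (^ℤ-proj₁ Q k)) (G.trans (proj₁ Qᵏ≈) (G.trans (eval-transport₁ X Y w) w≈h))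

  module _ {m′ n′} (annG : PG.Annihilates (suc m′)) (annH : PH.Annihilates (suc n′))
           (coprime : Coprime (suc m′) (suc n′)) where
    private
      separating₁ = coprime⇒separating-exponent G H m′ n′ annG annH coprime
      separating₂ = coprime⇒separating-exponent H G n′ m′ annH annG (Coprimality.sym coprime)
      K₁ = proj₁ separating₁
      K₂ = proj₁ separating₂
      K₁-fixes = proj₁ (proj₂ separating₁)
      K₁-kills = proj₂ (proj₂ separating₁)
      K₂-fixes = proj₁ (proj₂ separating₂)
      K₂-kills = proj₂ (proj₂ separating₂)

    -- (g , t) = X ^ K₁ ∙ Y ^ K₂, and (g , t) ^ (i K₁ + j K₂) = (g ^ i , t ^ j).
    Gen2Cyclic-× : ∀ {a b z w} → Gen2Cyclic G a b → Gen2Cyclic H z w → Gen2Cyclic P (a , z) (b , w)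
    Gen2Cyclic-× {a} {b} {z} {w} (g , (U , U≈g) , cyclicG) (t , (V , V≈t) , cyclicH) =
      (g , t) , (generator , generator≈) , λ h h∈ →
        let i , gⁱ≈h₁ = Annihilated.InCyclic⇒InCyclicℕ G m′ annG (cyclicG (proj₁ h) (proj₁-InGen2 h∈))
            j , tʲ≈h₂ = Annihilated.InCyclic⇒InCyclicℕ H n′ annH (cyclicH (proj₂ h) (proj₂-InGen2 h∈))
        in ℤ.+ (i * K₁ + j * K₂) , P.trans (^-× (g , t) (i * K₁ + j * K₂))
             ( G.trans (PG.^-+-fixed-annihilated i j (K₁-fixes g) (K₂-kills g)) gⁱ≈h₁
             , H.trans (H.reflexive (≡.cong (t PH.^_) (+-comm (i * K₁) (j * K₂))))
                 (H.trans (PH.^-+-fixed-annihilated j i (K₂-fixes t) (K₁-kills t)) tʲ≈h₂))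
      where
      A B : P.Carrier
      A = a , z
      B = b , w
      generator : Word P
      generator = (transport U WP.^ʷ K₁) · (transport V WP.^ʷ K₂)
      X = eval P A B (transport U)
      Y = eval P A B (transport V)
      generator≈ : eval P A B generator P.≈ (g , t)
      generator≈ = P.trans
        (P.∙-cong (P.trans (WP.eval-^ʷ A B (transport U) K₁) (^-× X K₁))
                  (P.trans (WP.eval-^ʷ A B (transport V) K₂) (^-× Y K₂)))
        ( G.trans (G.∙-cong (K₁-fixes _) (K₂-kills _))
            (G.trans (G.identityʳ _) (G.trans (eval-transport₁ A B U) U≈g))
        , H.trans (H.∙-cong (K₁-kills _) (K₂-fixes _))
            (H.trans (H.identityˡ _) (H.trans (eval-transport₂ A B V) V≈t)))

    Gen2Cyclic-×⇔ : ∀ {t} → (∀ y → InCyclic H t y) →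
      ∀ X Y → Gen2Cyclic P X Y ⇔ Gen2Cyclic G (proj₁ X) (proj₁ Y)
    Gen2Cyclic-×⇔ generates X Y = mk⇔ Gen2Cyclic-proj₁ λ cyclic →
      Gen2Cyclic-× cyclic (Annihilated.cyclic⇒Gen2Cyclic H n′ annH generates (proj₂ X) (proj₂ Y))

module _ {c ℓ c′ ℓ′} {G : Group c ℓ} {H : Group c′ ℓ′} (Γ : FinGraph) (twinFree : NoClosedTwins Γ)
  (Gen2Cyclic-reflexive : ∀ {x y} → Group._≈_ G x y → Gen2Cyclic G x y)
  (Gen2Cyclic-×⇔ : ∀ X Y → Gen2Cyclic (group G H) X Y ⇔ Gen2Cyclic G (proj₁ X) (proj₁ Y))
  where
  private
    module G = Group G
    module H = Group H
  open FinGraph Γ using (Adj; irrefl)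
  open Equivalence using (to; from)

  Free-×⇒Free : Free (group G H) Γ → Free G Γ
  Free-×⇒Free free-× (f , f-inj , f-adj) = free-× (F , (λ i j → f-inj i j ∘ proj₁) , F-adj)
    where
    F : Fin (FinGraph.k Γ) → Group.Carrier (group G H)
    F i = f i , H.ε
    F-adj : ∀ i j → Adj i j ⇔ EPAdj (group G H) (F i) (F j)
    F-adj i j = mk⇔
      (λ adj → let f≉ , cyclic = to (f-adj i j) adj in f≉ ∘ proj₁ , from (Gen2Cyclic-×⇔ (F i) (F j)) cyclic)
      (λ (F≉ , cyclic) →
        from (f-adj i j) ((λ f≈ → F≉ (f≈ , H.refl)) , to (Gen2Cyclic-×⇔ (F i) (F j)) cyclic))

  Free⇒Free-× : Free G Γ → Free (group G H) Γ
  Free⇒Free-× free (F , F-inj , F-adj) = free (f , f-inj , f-adj)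
    where
    f : Fin (FinGraph.k Γ) → G.Carrier
    f = proj₁ ∘ F
    adj⇔ : ∀ i j → Adj i j ⇔ (¬ i ≡ j × Gen2Cyclic G (f i) (f j))
    adj⇔ i j = mk⇔
      (λ adj → (λ { ≡.refl → irrefl adj }) , to (Gen2Cyclic-×⇔ (F i) (F j)) (proj₂ (to (F-adj i j) adj)))
      (λ (i≢j , cyclic) → from (F-adj i j) (i≢j ∘ F-inj i j , from (Gen2Cyclic-×⇔ (F i) (F j)) cyclic))
    nbhd⊆ : ∀ {i j} → f i G.≈ f j → ∀ w → ClosedNbhd Γ i w → ClosedNbhd Γ j w
    nbhd⊆ {i} {j} fi≈fj w (inj₁ ≡.refl) with i Fin.≟ j
    ... | yes i≡j = inj₁ i≡j
    ... | no i≢j = inj₂ (from (adj⇔ j i) (i≢j ∘ ≡.sym , Gen2Cyclic-reflexive (G.sym fi≈fj)))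
    nbhd⊆ {i} {j} fi≈fj w (inj₂ adj) with w Fin.≟ j
    ... | yes w≡j = inj₁ w≡j
    ... | no w≢j =
      inj₂ (from (adj⇔ j w) (w≢j ∘ ≡.sym , Words.Gen2Cyclic-respˡ G fi≈fj (proj₂ (to (adj⇔ i w) adj))))
    f-inj : ∀ i j → f i G.≈ f j → i ≡ j
    f-inj i j fi≈fj = twinFree i j λ w → mk⇔ (nbhd⊆ fi≈fj w) (nbhd⊆ (G.sym fi≈fj) w)
    f-adj : ∀ i j → Adj i j ⇔ EPAdj G (f i) (f j)
    f-adj i j = mk⇔
      (λ adj → let i≢j , cyclic = to (adj⇔ i j) adj in i≢j ∘ f-inj i j , cyclic)
      (λ (f≉ , cyclic) → from (adj⇔ i j) ((λ { ≡.refl → f≉ G.refl }) , cyclic))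

  Free-×⇔Free : Free (group G H) Γ ⇔ Free G Γ
  Free-×⇔Free = mk⇔ Free-×⇒Free Free⇒Free-×

lemma4p1 : ∀ {c ℓ c′ ℓ′} (Γ : FinGraph) → NoClosedTwins Γ →
    (G : Group c ℓ) (finG : IsFiniteGroup G) →
    (n : ℕ) → n > 0 → Coprime n (IsFiniteGroup.order finG) →
    (Zn : Group c′ ℓ′) → IsCyclicOfOrder Zn n →
    (Free (group G Zn) Γ ⇔ Free G Γ)
lemma4p1 Γ twinFree G finG (suc n′) _ coprime Zn cyclic =
  Free-×⇔Free Γ twinFree (Annihilated.Gen2Cyclic-reflexive G m′ annG)
    (DirectProduct.Gen2Cyclic-×⇔ G Zn annG annZn coprime′ generates)
  where
  open IsCyclicOfOrder cyclic
  m′ = pred (IsFiniteGroup.order finG)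
  annG : Powers.Annihilates G (suc m′)
  annG = FiniteGroup.annihilated G finG
  annZn : Powers.Annihilates Zn (suc n′)
  annZn = ≡.subst (Powers.Annihilates Zn) order≡n (FiniteGroup.^-order Zn finite)
  coprime′ : Coprime (suc m′) (suc n′)
  coprime′ = ≡.subst (λ m → Coprime m (suc n′)) (≡.sym (FiniteGroup.suc-pred-order G finG))
    (Coprimality.sym coprime)
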